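{- Let $n$ be a weakly almost-prime number and let $p$ be a prime divisor of $n$. Then for any positive divisor $m$ of $p-1$ and any integer $r$ with $r\not\equiv 1\pmod m$, the number of positive divisors of $n$ congruent to $r$ modulo $m$ is divisible by $p$.
   Context: For a positive integer $n$ with positive divisors $1=d_1<d_2<\dots<d_k=n$, define the polynomial $T_n(x)=x^{d_1}+x^{d_2}+\dots+x^{d_k}-kx$. A positive integer $n$ is called weakly almost-prime if $n\mid T_n(x)$ for all integers $x$. -}

module Defs where

open import Data.Nat as ℕ using (ℕ; suc)
open import Data.Nat.Divisibility as ℕD using (_∣?_)
open import Data.Integer as ℤ using (ℤ; +_; _-_; _^_)
open import Data.Integer.Divisibility as ℤD using ()
open import Data.List using (List; filter; map; upTo; length; foldr)
open import Data.Product using (_×_)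

divisors : ℕ → List ℕ
divisors n = filter (λ d → d ∣? n) (map suc (upTo n))

numDivisors : ℕ → ℕ
numDivisors n = length (divisors n)

T : ℕ → ℤ → ℤ
T n x = foldr (λ d acc → x ^ d ℤ.+ acc) (+ 0) (divisors n) - (+ numDivisors n) ℤ.* x

WeaklyAlmostPrime : ℕ → Set
WeaklyAlmostPrime n = 1 ℕ.≤ n × (∀ (x : ℤ) → (+ n) ℤD.∣ T n x)

countDivisorsCong : ℕ → ℕ → ℤ → ℕ
countDivisorsCong n m r = length (filter (λ d → m ∣? ℤ.∣ (+ d) - r ∣) (divisors n))

-- Write q = p - 1 and S(t) = ∑_{x<p} x^t.  Binomial expansion of (x+1)^(t+1) - x^(t+1)
-- gives a recurrence showing p ∣ S(t) for t < q, and Fermat's little theorem gives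
-- S(q) ≡ -1 and S(t + q) ≡ S(t) for t ≥ 1, so S(t) ≡ -[q ∣ t] (mod p) for all t ≥ 1.
-- As p ∣ T_n(x) for every x, p divides ∑_{x<p} x^e T_n(x) = ∑_{d ∣ n} S(d + e) - k S(1 + e),
-- that is, p ∣ a_j - k [j ≡ 1] for every class j mod q, where a_j counts the divisors
-- d ≡ j (mod q).  Since m ∣ q, the divisors d ≡ r (mod m) are the union of the classes
-- j ≡ r (mod m), none of which is the class of 1 because r ≢ 1 (mod m).

module Submission where

open import Defs
open import Data.Nat using (ℕ; _∸_)
open import Data.Nat.Divisibility using (_∣_)
open import Data.Nat.Primality using (Prime)
open import Data.Integer using (ℤ; +_; _-_)
open import Data.Integer.Divisibility using () renaming (_∣_ to _∣ℤ_)
open import Relation.Nullary using (¬_)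

open import Data.Nat.Base as ℕ using (zero; suc; _!; NonZero; _<_; _≤_; z≤n; s≤s)
import Data.Nat.Properties as ℕ
open import Data.Nat.Divisibility as ℕ using (_∤_; _∣?_)
open import Data.Nat.DivMod using (_/_; m≡m%n+[m/n]*n; m%n<n; m*[n/m]≡n)
open import Data.Nat.Induction using (<-rec)
open import Data.Nat.Primality using (euclidsLemma; prime⇒nonTrivial)
open import Data.Nat.Combinatorics using (_C_; nCn≡1; nC1≡n; nCk≡nC[n∸k]; nCk≡n!/k![n-k]!; k![n∸k]!∣n!)
open import Data.Integer.Base as ℤ using (_+_; _*_; _^_; 0ℤ; 1ℤ)
import Data.Integer.Properties as ℤ
open import Data.Integer.Divisibility.Signed as ℤ using () renaming (_∣_ to _∣ᶻ_)
open import Data.Integer.Tactic.RingSolver using (solve-∀)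
open import Data.Fin.Base using (toℕ)
open import Data.List.Base using (List; []; _∷_; _++_; [_]; map; filter; length; foldr; upTo)
import Data.List.Properties as List
open import Data.List.Relation.Unary.All as All using (All; []; _∷_; universal)
import Data.List.Relation.Unary.All.Properties as All
open import Data.Sum.Base using (inj₁; inj₂)
open import Data.Product.Base using (_,_)
open import Function.Base using (_∘_)
open import Relation.Nullary using (Dec; yes; no; contradiction)
open import Relation.Unary using (Decidable)
open import Relation.Binary.PropositionalEquality using (_≡_; refl; sym; trans; cong; cong₂; subst; module ≡-Reasoning)
open ≡-Reasoning

import Algebra.Properties.CommutativeSemiring.Binomial ℤ.+-*-commutativeSemiring as Binomial
import Algebra.Properties.Semiring.Exp ℤ.+-*-semiring as Exp
import Algebra.Properties.Semiring.Mult ℤ.+-*-semiring as Mult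
import Algebra.Properties.Semiring.Sum ℤ.+-*-semiring as FinSum
open import Algebra.Bundles using (AbelianGroup)
open import Algebra.Properties.Group (AbelianGroup.group ℤ.+-0-abelianGroup) using () renaming (∙-cancelʳ to +-cancelʳ)

⟦_⟧ : ∀ {a} {A : Set a} → Dec A → ℤ
⟦ yes _ ⟧ = 1ℤ
⟦ no _ ⟧ = 0ℤ

⟦⟧-yes : ∀ {a} {A : Set a} (a? : Dec A) → A → ⟦ a? ⟧ ≡ 1ℤ
⟦⟧-yes (yes _) _ = refl
⟦⟧-yes (no ¬a) a = contradiction a ¬a

⟦⟧-no : ∀ {a} {A : Set a} (a? : Dec A) → ¬ A → ⟦ a? ⟧ ≡ 0ℤ
⟦⟧-no (yes a) ¬a = contradiction a ¬a
⟦⟧-no (no _) _ = refl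

⟦⟧-cong : ∀ {a b} {A : Set a} {B : Set b} (a? : Dec A) (b? : Dec B) →
  (A → B) → (B → A) → ⟦ a? ⟧ ≡ ⟦ b? ⟧
⟦⟧-cong (yes a) b? A→B B→A = sym (⟦⟧-yes b? (A→B a))
⟦⟧-cong (no ¬a) b? A→B B→A = sym (⟦⟧-no b? (¬a ∘ B→A))

⟦∣⟧-periodic : ∀ q a → ⟦ q ∣? a ℕ.+ q ⟧ ≡ ⟦ q ∣? a ⟧
⟦∣⟧-periodic q a = ⟦⟧-cong (q ∣? a ℕ.+ q) (q ∣? a)
  (λ q∣a+q → ℕ.∣m+n∣m⇒∣n (subst (q ∣_) (ℕ.+-comm a q) q∣a+q) ℕ.∣-refl)
  (λ q∣a → ℕ.∣m∣n⇒∣m+n q∣a ℕ.∣-refl)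

-- A right fold, so that T n x unfolds definitionally to ∑[ d ∈ divisors n ] x ^ d - k * x.
∑ : List ℕ → (ℕ → ℤ) → ℤ
∑ xs f = foldr (λ x s → f x + s) 0ℤ xs

infix 6.5 ∑
syntax ∑ xs (λ x → e) = ∑[ x ∈ xs ] e

∑-cong : ∀ xs {f g : ℕ → ℤ} → (∀ x → f x ≡ g x) → ∑ xs f ≡ ∑ xs g
∑-cong [] f≗g = refl
∑-cong (x ∷ xs) f≗g = cong₂ _+_ (f≗g x) (∑-cong xs f≗g)

∑-zero : ∀ {xs} {f : ℕ → ℤ} → All (λ x → f x ≡ 0ℤ) xs → ∑ xs f ≡ 0ℤ
∑-zero [] = refl
∑-zero (fx≡0 ∷ fxs≡0) = cong₂ _+_ fx≡0 (∑-zero fxs≡0)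

∑-const : ∀ xs c → ∑[ x ∈ xs ] c ≡ + length xs * c
∑-const [] c = sym (ℤ.*-zeroˡ c)
∑-const (x ∷ xs) c = trans (cong (_+_ c) (∑-const xs c)) (sym (ℤ.suc-* (+ length xs) c))

∑-++ : ∀ xs ys (f : ℕ → ℤ) → ∑ (xs ++ ys) f ≡ ∑ xs f + ∑ ys f
∑-++ [] ys f = sym (ℤ.+-identityˡ (∑ ys f))
∑-++ (x ∷ xs) ys f = trans (cong (_+_ (f x)) (∑-++ xs ys f)) (sym (ℤ.+-assoc (f x) (∑ xs f) (∑ ys f)))

∑-map : ∀ (g : ℕ → ℕ) xs (f : ℕ → ℤ) → ∑ (map g xs) f ≡ ∑[ x ∈ xs ] f (g x)
∑-map g [] f = refl
∑-map g (x ∷ xs) f = cong (_+_ (f (g x))) (∑-map g xs f)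

∑-distrib-+ : ∀ xs (f g : ℕ → ℤ) → ∑[ x ∈ xs ] (f x + g x) ≡ ∑ xs f + ∑ xs g
∑-distrib-+ [] f g = refl
∑-distrib-+ (x ∷ xs) f g = trans (cong (_+_ (f x + g x)) (∑-distrib-+ xs f g)) (interchange (f x) (g x) _ _)
  where
  interchange : ∀ a b c d → (a + b) + (c + d) ≡ (a + c) + (b + d)
  interchange = solve-∀

∑-distrib-- : ∀ xs (f g : ℕ → ℤ) → ∑[ x ∈ xs ] (f x - g x) ≡ ∑ xs f - ∑ xs g
∑-distrib-- [] f g = refl
∑-distrib-- (x ∷ xs) f g = trans (cong (_+_ (f x - g x)) (∑-distrib-- xs f g)) (interchange (f x) (g x) _ _)
  where
  interchange : ∀ a b c d → (a - b) + (c - d) ≡ (a + c) - (b + d)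
  interchange = solve-∀

*-distribˡ-∑ : ∀ c xs (f : ℕ → ℤ) → c * ∑ xs f ≡ ∑[ x ∈ xs ] (c * f x)
*-distribˡ-∑ c [] f = ℤ.*-zeroʳ c
*-distribˡ-∑ c (x ∷ xs) f =
  trans (ℤ.*-distribˡ-+ c (f x) (∑ xs f)) (cong (_+_ (c * f x)) (*-distribˡ-∑ c xs f))

∑-comm : ∀ xs ys (f : ℕ → ℕ → ℤ) →
  ∑[ x ∈ xs ] ∑[ y ∈ ys ] f x y ≡ ∑[ y ∈ ys ] ∑[ x ∈ xs ] f x y
∑-comm [] ys f = sym (trans (∑-const ys 0ℤ) (ℤ.*-zeroʳ (+ length ys)))
∑-comm (x ∷ xs) ys f = trans (cong (_+_ (∑ ys (f x))) (∑-comm xs ys f))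
  (sym (∑-distrib-+ ys (f x) (λ y → ∑[ x ∈ xs ] f x y)))

∣ᶻ-∑ : ∀ {i xs} {f : ℕ → ℤ} → All (λ x → i ∣ᶻ f x) xs → i ∣ᶻ ∑ xs f
∣ᶻ-∑ {i} [] = ℤ.divides 0ℤ (sym (ℤ.*-zeroˡ i))
∣ᶻ-∑ (i∣fx ∷ i∣fxs) = ℤ.∣m∣n⇒∣m+n i∣fx (∣ᶻ-∑ i∣fxs)

length-filter : ∀ {P : ℕ → Set} (P? : Decidable P) xs →
  + length (filter P? xs) ≡ ∑[ x ∈ xs ] ⟦ P? x ⟧
length-filter P? [] = refl
length-filter P? (x ∷ xs) with P? x
... | yes _ = cong (_+_ 1ℤ) (length-filter P? xs)
... | no _ = trans (length-filter P? xs) (sym (ℤ.+-identityˡ _))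

∑-upTo-suc : ∀ n (f : ℕ → ℤ) → ∑[ x ∈ upTo (suc n) ] f x ≡ f 0 + ∑[ x ∈ upTo n ] f (suc x)
∑-upTo-suc n f = cong (_+_ (f 0))
  (trans (cong (λ xs → ∑ xs f) (sym (List.map-upTo suc n))) (∑-map suc (upTo n) f))

∑-upTo-∷ʳ : ∀ n (f : ℕ → ℤ) → ∑[ x ∈ upTo (suc n) ] f x ≡ ∑[ x ∈ upTo n ] f x + f n
∑-upTo-∷ʳ n f = begin
  ∑ (upTo (suc n)) f           ≡⟨ cong (λ xs → ∑ xs f) (List.upTo-∷ʳ n) ⟨
  ∑ (upTo n ++ [ n ]) f        ≡⟨ ∑-++ (upTo n) [ n ] f ⟩
  ∑ (upTo n) f + (f n + 0ℤ)    ≡⟨ cong (_+_ (∑ (upTo n) f)) (ℤ.+-identityʳ (f n)) ⟩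
  ∑ (upTo n) f + f n           ∎

∑-upTo-shift : ∀ n (f : ℕ → ℤ) → ∑[ x ∈ upTo n ] f (suc x) + f 0 ≡ ∑[ x ∈ upTo n ] f x + f n
∑-upTo-shift n f = begin
  ∑[ x ∈ upTo n ] f (suc x) + f 0  ≡⟨ ℤ.+-comm _ (f 0) ⟩
  f 0 + ∑[ x ∈ upTo n ] f (suc x)  ≡⟨ ∑-upTo-suc n f ⟨
  ∑[ x ∈ upTo (suc n) ] f x        ≡⟨ ∑-upTo-∷ʳ n f ⟩
  ∑[ x ∈ upTo n ] f x + f n        ∎

∑-telescope : ∀ n (f : ℕ → ℤ) → ∑[ x ∈ upTo n ] (f (suc x) - f x) ≡ f n - f 0
∑-telescope n f = begin
  ∑[ x ∈ upTo n ] (f (suc x) - f x)   ≡⟨ ∑-distrib-- (upTo n) (f ∘ suc) f ⟩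
  a - b                               ≡⟨ add-rightʳ (f 0) a b ⟩
  (a + f 0) - (b + f 0)               ≡⟨ cong (_- (b + f 0)) (∑-upTo-shift n f) ⟩
  (b + f n) - (b + f 0)               ≡⟨ add-leftʳ b (f n) (f 0) ⟨
  f n - f 0                           ∎
  where
  a : ℤ
  a = ∑[ x ∈ upTo n ] f (suc x)
  b : ℤ
  b = ∑[ x ∈ upTo n ] f x
  add-rightʳ : ∀ c a b → a - b ≡ (a + c) - (b + c)
  add-rightʳ = solve-∀
  add-leftʳ : ∀ c a b → a - b ≡ (c + a) - (c + b)
  add-leftʳ = solve-∀

∑-periodic : ∀ q (f : ℕ → ℤ) → (∀ x → f (x ℕ.+ q) ≡ f x) →
  ∀ d → ∑[ e ∈ upTo q ] f (d ℕ.+ e) ≡ ∑[ e ∈ upTo q ] f e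
∑-periodic q f f-periodic zero = refl
∑-periodic q f f-periodic (suc d) = begin
  ∑[ e ∈ upTo q ] f (suc d ℕ.+ e)    ≡⟨ ∑-cong (upTo q) (λ e → cong f (sym (ℕ.+-suc d e))) ⟩
  ∑[ e ∈ upTo q ] f (d ℕ.+ suc e)    ≡⟨ +-cancelʳ _ _ _ rotated ⟩
  ∑[ e ∈ upTo q ] f (d ℕ.+ e)        ≡⟨ ∑-periodic q f f-periodic d ⟩
  ∑[ e ∈ upTo q ] f e                ∎
  where
  g : ℕ → ℤ
  g e = f (d ℕ.+ e)
  g[q]≡g[0] : g q ≡ g 0
  g[q]≡g[0] = trans (f-periodic d) (cong f (sym (ℕ.+-identityʳ d)))
  rotated : ∑[ e ∈ upTo q ] g (suc e) + g 0 ≡ ∑[ e ∈ upTo q ] g e + g 0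
  rotated = trans (∑-upTo-shift q g) (cong (_+_ (∑ (upTo q) g)) g[q]≡g[0])

∑-⟦∣⟧ : ∀ q .{{_ : NonZero q}} d → ∑[ e ∈ upTo q ] ⟦ q ∣? d ℕ.+ e ⟧ ≡ 1ℤ
∑-⟦∣⟧ q@(suc q-1) d = begin
  ∑[ e ∈ upTo q ] ⟦ q ∣? d ℕ.+ e ⟧               ≡⟨ ∑-periodic q (λ e → ⟦ q ∣? e ⟧) (⟦∣⟧-periodic q) d ⟩
  ∑[ e ∈ upTo q ] ⟦ q ∣? e ⟧                     ≡⟨ ∑-upTo-suc q-1 (λ e → ⟦ q ∣? e ⟧) ⟩
  ⟦ q ∣? 0 ⟧ + ∑[ e ∈ upTo q-1 ] ⟦ q ∣? suc e ⟧  ≡⟨ cong₂ _+_ (⟦⟧-yes (q ∣? 0) (q ℕ.∣0)) (∑-zero q∤1+e) ⟩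
  1ℤ + 0ℤ                                        ∎
  where
  q∤1+e : All (λ e → ⟦ q ∣? suc e ⟧ ≡ 0ℤ) (upTo q-1)
  q∤1+e = All.applyUpTo⁺₁ (λ e → e) q-1 (λ {e} e<q-1 → ⟦⟧-no (q ∣? suc e) (ℕ.>⇒∤ (s≤s e<q-1)))

∑-select : ∀ q .{{_ : NonZero q}} d {c} (f : ℕ → ℤ) → (∀ e → q ∣ d ℕ.+ e → f e ≡ c) →
  ∑[ e ∈ upTo q ] f e * ⟦ q ∣? d ℕ.+ e ⟧ ≡ c
∑-select q d {c} f f≡c = begin
  ∑[ e ∈ upTo q ] f e * ⟦ q ∣? d ℕ.+ e ⟧     ≡⟨ ∑-cong (upTo q) selected ⟩
  ∑[ e ∈ upTo q ] c * ⟦ q ∣? d ℕ.+ e ⟧       ≡⟨ *-distribˡ-∑ c (upTo q) (λ e → ⟦ q ∣? d ℕ.+ e ⟧) ⟨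
  c * (∑[ e ∈ upTo q ] ⟦ q ∣? d ℕ.+ e ⟧)     ≡⟨ cong (_*_ c) (∑-⟦∣⟧ q d) ⟩
  c * 1ℤ                                     ≡⟨ ℤ.*-identityʳ c ⟩
  c                                          ∎
  where
  selected : ∀ e → f e * ⟦ q ∣? d ℕ.+ e ⟧ ≡ c * ⟦ q ∣? d ℕ.+ e ⟧
  selected e with q ∣? d ℕ.+ e
  ... | yes q∣d+e = cong (_* 1ℤ) (f≡c e q∣d+e)
  ... | no _ = trans (ℤ.*-zeroʳ (f e)) (sym (ℤ.*-zeroʳ c))

periodic-induction : ∀ {ℓ} (P : ℕ → Set ℓ) q .{{_ : NonZero q}} →
  (∀ {t} → t < q → P t) → (∀ {t} → P t → P (t ℕ.+ q)) → ∀ t → P t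
periodic-induction P q base step t =
  subst P (sym (m≡m%n+[m/n]*n t q)) (iterate (t / q) (base (m%n<n t q)))
  where
  iterate : ∀ k {r} → P r → P (r ℕ.+ k ℕ.* q)
  iterate zero {r} Pr = subst P (sym (ℕ.+-identityʳ r)) Pr
  iterate (suc k) {r} Pr = subst P (trans (ℕ.+-assoc r (k ℕ.* q) q) (cong (r ℕ.+_) (ℕ.+-comm (k ℕ.* q) q)))
    (step (iterate k Pr))

×≡* : ∀ n x → n Mult.× x ≡ + n * x
×≡* zero x = sym (ℤ.*-zeroˡ x)
×≡* (suc n) x = trans (cong (_+_ x) (×≡* n x)) (sym (ℤ.suc-* (+ n) x))

^≡^ : ∀ x n → x Exp.^ n ≡ x ^ n
^≡^ x zero = refl
^≡^ x (suc n) = cong (_*_ x) (^≡^ x n)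

sum≡∑-upTo : ∀ n (f : ℕ → ℤ) → FinSum.sum {n} (λ i → f (toℕ i)) ≡ ∑[ x ∈ upTo n ] f x
sum≡∑-upTo zero f = refl
sum≡∑-upTo (suc n) f = trans (cong (_+_ (f 0)) (sum≡∑-upTo n (f ∘ suc))) (sym (∑-upTo-suc n f))

binomial : ∀ n x → (x + 1ℤ) ^ n ≡ ∑[ i ∈ upTo (suc n) ] (+ (n C i) * x ^ i)
binomial n x = begin
  (x + 1ℤ) ^ n
    ≡⟨ ^≡^ (x + 1ℤ) n ⟨
  (x + 1ℤ) Exp.^ n
    ≡⟨ Binomial.theorem n x 1ℤ ⟩
  Binomial.binomialExpansion x 1ℤ n
    ≡⟨ FinSum.sum-cong-≗ {suc n} term ⟩
  FinSum.sum {suc n} (λ i → + (n C toℕ i) * x ^ toℕ i)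
    ≡⟨ sum≡∑-upTo (suc n) (λ i → + (n C i) * x ^ i) ⟩
  ∑[ i ∈ upTo (suc n) ] (+ (n C i) * x ^ i) ∎
  where
  term : ∀ i → Binomial.binomialTerm x 1ℤ n i ≡ + (n C toℕ i) * x ^ toℕ i
  term i = begin
    c Mult.× (x Exp.^ k * 1ℤ Exp.^ (n ∸ k))  ≡⟨ ×≡* c _ ⟩
    + c * (x Exp.^ k * 1ℤ Exp.^ (n ∸ k))     ≡⟨ cong₂ (λ a b → + c * (a * b)) (^≡^ x k) 1^[n∸k]≡1 ⟩
    + c * (x ^ k * 1ℤ)                       ≡⟨ cong (_*_ (+ c)) (ℤ.*-identityʳ (x ^ k)) ⟩
    + c * x ^ k                              ∎
    where
    k : ℕ
    k = toℕ i
    c : ℕ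
    c = n C k
    1^[n∸k]≡1 : 1ℤ Exp.^ (n ∸ k) ≡ 1ℤ
    1^[n∸k]≡1 = trans (^≡^ 1ℤ (n ∸ k)) (ℤ.^-zeroˡ (n ∸ k))

binomial-difference : ∀ n x → (x + 1ℤ) ^ suc n - x ^ suc n ≡ ∑[ i ∈ upTo (suc n) ] (+ (suc n C i) * x ^ i)
binomial-difference n x = begin
  (x + 1ℤ) ^ suc n - x ^ suc n                        ≡⟨ cong (_- x ^ suc n) (binomial (suc n) x) ⟩
  ∑ (upTo (suc (suc n))) f - x ^ suc n                ≡⟨ cong (_- x ^ suc n) (∑-upTo-∷ʳ (suc n) f) ⟩
  (lower + + (suc n C suc n) * x ^ suc n) - x ^ suc n
    ≡⟨ cong (λ c → (lower + + c * x ^ suc n) - x ^ suc n) (nCn≡1 (suc n)) ⟩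
  (lower + 1ℤ * x ^ suc n) - x ^ suc n                ≡⟨ cancel lower (x ^ suc n) ⟩
  lower                                               ∎
  where
  f : ℕ → ℤ
  f i = + (suc n C i) * x ^ i
  lower : ℤ
  lower = ∑ (upTo (suc n)) f
  cancel : ∀ a b → (a + 1ℤ * b) - b ≡ a
  cancel = solve-∀

[1+n]Cn≡1+n : ∀ n → suc n C n ≡ suc n
[1+n]Cn≡1+n n = begin
  suc n C n               ≡⟨ nCk≡nC[n∸k] (ℕ.n≤1+n n) ⟩
  suc n C (suc n ∸ n)     ≡⟨ cong (suc n C_) (ℕ.m+n∸n≡m 1 n) ⟩
  suc n C 1               ≡⟨ nC1≡n (suc n) ⟩
  suc n                   ∎

prime∤! : ∀ {p m} → Prime p → m < p → p ∤ m !
prime∤! {m = zero} p-prime _ p∣1 with ℕ.∣1⇒≡1 p∣1 | prime⇒nonTrivial p-prime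
... | refl | ()
prime∤! {m = suc m} p-prime m<p p∣m! with euclidsLemma (suc m) (m !) p-prime p∣m!
... | inj₁ p∣1+m = ℕ.>⇒∤ m<p p∣1+m
... | inj₂ p∣m! = prime∤! p-prime (ℕ.<-trans (ℕ.n<1+n m) m<p) p∣m!

k!*[n∸k]!*nCk≡n! : ∀ {n k} → k ≤ n → k ! ℕ.* (n ∸ k) ! ℕ.* (n C k) ≡ n !
k!*[n∸k]!*nCk≡n! {n} {k} k≤n = trans (cong (k ! ℕ.* (n ∸ k) ! ℕ.*_) (nCk≡n!/k![n-k]! k≤n))
  (m*[n/m]≡n {{k ℕ.!* (n ∸ k) !≢0}} (k![n∸k]!∣n! k≤n))

prime∣pCk : ∀ {p k} → Prime p → 0 < k → k < p → p ∣ p C k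
prime∣pCk {suc p-1} {k@(suc k-1)} p-prime _ k<p
  with euclidsLemma (k ! ℕ.* (suc p-1 ∸ k) !) (suc p-1 C k) p-prime
         (subst (suc p-1 ∣_) (sym (k!*[n∸k]!*nCk≡n! (ℕ.<⇒≤ k<p))) (ℕ.m∣m*n (p-1 !)))
... | inj₂ p∣pCk = p∣pCk
... | inj₁ p∣k!*[p∸k]! with euclidsLemma (k !) ((suc p-1 ∸ k) !) p-prime p∣k!*[p∸k]!
...   | inj₁ p∣k! = contradiction p∣k! (prime∤! p-prime k<p)
...   | inj₂ p∣[p∸k]! = contradiction p∣[p∸k]! (prime∤! p-prime (s≤s (ℕ.m∸n≤m p-1 k-1)))

euclidsLemmaᶻ : ∀ {p a} y → Prime p → + p ∣ᶻ + a * y → p ∤ a → + p ∣ᶻ y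
euclidsLemmaᶻ {p} {a} y p-prime p∣ay p∤a
  with euclidsLemma a ℤ.∣ y ∣ p-prime (subst (p ∣_) (ℤ.abs-* (+ a) y) (ℤ.∣⇒∣ᵤ p∣ay))
... | inj₁ p∣a = contradiction p∣a p∤a
... | inj₂ p∣y = ℤ.∣ᵤ⇒∣ p∣y

prime⇒pred-nonZero : ∀ {q} → Prime (suc q) → NonZero q
prime⇒pred-nonZero {q} p-prime =
  ℕ.>-nonZero (ℕ.s≤s⁻¹ (ℕ.nonTrivial⇒n>1 (suc q) {{prime⇒nonTrivial p-prime}}))

powerSum : ℕ → ℕ → ℤ
powerSum N t = ∑[ x ∈ upTo N ] (+ x) ^ t

powerSum-recurrence : ∀ N t → ∑[ i ∈ upTo (suc t) ] (+ (suc t C i) * powerSum N i) ≡ (+ N) ^ suc t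
powerSum-recurrence N t = begin
  ∑[ i ∈ upTo (suc t) ] (+ (suc t C i) * powerSum N i)
    ≡⟨ ∑-cong (upTo (suc t)) (λ i → *-distribˡ-∑ (+ (suc t C i)) (upTo N) (λ x → (+ x) ^ i)) ⟩
  ∑[ i ∈ upTo (suc t) ] ∑[ x ∈ upTo N ] (+ (suc t C i) * (+ x) ^ i)
    ≡⟨ ∑-comm (upTo (suc t)) (upTo N) (λ i x → + (suc t C i) * (+ x) ^ i) ⟩
  ∑[ x ∈ upTo N ] ∑[ i ∈ upTo (suc t) ] (+ (suc t C i) * (+ x) ^ i)
    ≡⟨ ∑-cong (upTo N) difference ⟨
  ∑[ x ∈ upTo N ] ((+ suc x) ^ suc t - (+ x) ^ suc t)
    ≡⟨ ∑-telescope N (λ x → (+ x) ^ suc t) ⟩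
  (+ N) ^ suc t - 0ℤ
    ≡⟨ ℤ.+-identityʳ ((+ N) ^ suc t) ⟩
  (+ N) ^ suc t ∎
  where
  difference : ∀ x → (+ suc x) ^ suc t - (+ x) ^ suc t ≡ ∑[ i ∈ upTo (suc t) ] (+ (suc t C i) * (+ x) ^ i)
  difference x = trans (cong (λ y → y ^ suc t - (+ x) ^ suc t) (ℤ.+-comm 1ℤ (+ x))) (binomial-difference t (+ x))

moment : ∀ n N e → ∑[ x ∈ upTo N ] (+ x) ^ e * T n (+ x) ≡
  ∑[ d ∈ divisors n ] powerSum N (d ℕ.+ e) - + numDivisors n * powerSum N (suc e)
moment n N e = begin
  ∑[ x ∈ upTo N ] (+ x) ^ e * T n (+ x)
    ≡⟨ ∑-cong (upTo N) pointwise ⟩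
  ∑[ x ∈ upTo N ] (∑[ d ∈ D ] (+ x) ^ (d ℕ.+ e) - K * (+ x) ^ suc e)
    ≡⟨ ∑-distrib-- (upTo N) (λ x → ∑[ d ∈ D ] (+ x) ^ (d ℕ.+ e)) (λ x → K * (+ x) ^ suc e) ⟩
  ∑[ x ∈ upTo N ] ∑[ d ∈ D ] (+ x) ^ (d ℕ.+ e) - ∑[ x ∈ upTo N ] K * (+ x) ^ suc e
    ≡⟨ cong₂ _-_ (∑-comm D (upTo N) (λ d x → (+ x) ^ (d ℕ.+ e)))
                 (*-distribˡ-∑ K (upTo N) (λ x → (+ x) ^ suc e)) ⟨
  ∑[ d ∈ D ] powerSum N (d ℕ.+ e) - K * powerSum N (suc e) ∎
  where
  D : List ℕ
  D = divisors n
  K : ℤ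
  K = + numDivisors n
  pointwise : ∀ x → (+ x) ^ e * T n (+ x) ≡ ∑[ d ∈ D ] (+ x) ^ (d ℕ.+ e) - K * (+ x) ^ suc e
  pointwise x = begin
    (+ x) ^ e * (∑[ d ∈ D ] (+ x) ^ d - K * + x)
      ≡⟨ distrib ((+ x) ^ e) (∑[ d ∈ D ] (+ x) ^ d) K (+ x) ⟩
    (+ x) ^ e * (∑[ d ∈ D ] (+ x) ^ d) - K * (+ x) ^ suc e
      ≡⟨ cong (_- K * (+ x) ^ suc e) (*-distribˡ-∑ ((+ x) ^ e) D (λ d → (+ x) ^ d)) ⟩
    ∑[ d ∈ D ] (+ x) ^ e * (+ x) ^ d - K * (+ x) ^ suc e
      ≡⟨ cong (_- K * (+ x) ^ suc e) (∑-cong D power-sum) ⟩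
    ∑[ d ∈ D ] (+ x) ^ (d ℕ.+ e) - K * (+ x) ^ suc e ∎
    where
    distrib : ∀ b s k a → b * (s - k * a) ≡ b * s - k * (a * b)
    distrib = solve-∀
    power-sum : ∀ d → (+ x) ^ e * (+ x) ^ d ≡ (+ x) ^ (d ℕ.+ e)
    power-sum d = trans (ℤ.*-comm ((+ x) ^ e) ((+ x) ^ d)) (sym (ℤ.^-distribˡ-+-* (+ x) d e))

-- The coefficient of the class j ≡ -e (mod q) in T_n reduced modulo x^q = 1.
reducedCoeff : ℕ → ℕ → ℕ → ℤ
reducedCoeff n q e = ∑[ d ∈ divisors n ] ⟦ q ∣? d ℕ.+ e ⟧ - + numDivisors n * ⟦ q ∣? suc e ⟧

divisors-positive : ∀ n → All (0 <_) (divisors n)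
divisors-positive n = All.filter⁺ (λ d → d ∣? n) (All.map⁺ (universal (λ _ → s≤s z≤n) (upTo n)))

residue-count : ∀ n {q m} .{{_ : NonZero q}} → m ∣ q → ∀ r →
  ∑[ e ∈ upTo q ] ⟦ m ∣? ℤ.∣ + e + r ∣ ⟧ * reducedCoeff n q e ≡
  + countDivisorsCong n m r - + numDivisors n * ⟦ m ∣? ℤ.∣ + 1 - r ∣ ⟧
residue-count n {q} {m} m∣q r = begin
  ∑[ e ∈ upTo q ] w e * reducedCoeff n q e
    ≡⟨ ∑-cong (upTo q) expand ⟩
  ∑[ e ∈ upTo q ] (∑[ d ∈ D ] wI d e - K * wI 1 e)
    ≡⟨ ∑-distrib-- (upTo q) (λ e → ∑[ d ∈ D ] wI d e) (λ e → K * wI 1 e) ⟩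
  ∑[ e ∈ upTo q ] ∑[ d ∈ D ] wI d e - ∑[ e ∈ upTo q ] K * wI 1 e
    ≡⟨ cong₂ _-_ (∑-comm D (upTo q) wI) (*-distribˡ-∑ K (upTo q) (wI 1)) ⟨
  ∑[ d ∈ D ] ∑[ e ∈ upTo q ] wI d e - K * (∑[ e ∈ upTo q ] wI 1 e)
    ≡⟨ cong₂ (λ a b → a - K * b) (∑-cong D (λ d → ∑-select q d w (w≡c d))) (∑-select q 1 w (w≡c 1)) ⟩
  ∑[ d ∈ D ] c d - K * c 1
    ≡⟨ cong (_- K * c 1) (length-filter (λ d → m ∣? ℤ.∣ + d - r ∣) D) ⟨
  + countDivisorsCong n m r - K * c 1 ∎
  where
  D : List ℕ
  D = divisors n
  K : ℤ
  K = + numDivisors n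
  w c : ℕ → ℤ
  w e = ⟦ m ∣? ℤ.∣ + e + r ∣ ⟧
  c d = ⟦ m ∣? ℤ.∣ + d - r ∣ ⟧
  wI : ℕ → ℕ → ℤ
  wI d e = w e * ⟦ q ∣? d ℕ.+ e ⟧
  expand : ∀ e → w e * reducedCoeff n q e ≡ ∑[ d ∈ D ] wI d e - K * wI 1 e
  expand e = trans (distrib (w e) (∑[ d ∈ D ] ⟦ q ∣? d ℕ.+ e ⟧) K ⟦ q ∣? suc e ⟧)
    (cong (_- K * wI 1 e) (*-distribˡ-∑ (w e) D (λ d → ⟦ q ∣? d ℕ.+ e ⟧)))
    where
    distrib : ∀ a s k b → a * (s - k * b) ≡ a * s - k * (a * b)
    distrib = solve-∀
  w≡c : ∀ d e → q ∣ d ℕ.+ e → w e ≡ c d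
  w≡c d e q∣d+e = ⟦⟧-cong (m ∣? ℤ.∣ + e + r ∣) (m ∣? ℤ.∣ + d - r ∣)
    (λ m∣e+r → ℤ.∣⇒∣ᵤ (ℤ.∣m+n∣m⇒∣n {+ m} {+ e + r} m∣sum (ℤ.∣ᵤ⇒∣ {+ m} {+ e + r} m∣e+r)))
    (λ m∣d-r → ℤ.∣⇒∣ᵤ (ℤ.∣m+n∣n⇒∣m {+ m} {+ e + r} m∣sum (ℤ.∣ᵤ⇒∣ {+ m} {+ d - r} m∣d-r)))
    where
    sum≡ : (+ e + r) + (+ d - r) ≡ + (d ℕ.+ e)
    sum≡ = trans (cancel (+ e) (+ d) r) (sym (ℤ.pos-+ d e))
      where
      cancel : ∀ a b r → (a + r) + (b - r) ≡ b + a
      cancel = solve-∀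
    m∣sum : + m ∣ᶻ (+ e + r) + (+ d - r)
    m∣sum = subst (+ m ∣ᶻ_) (sym sum≡) (ℤ.∣ᵤ⇒∣ {+ m} {+ (d ℕ.+ e)} (ℕ.∣-trans m∣q q∣d+e))

module _ {q} (p-prime : Prime (suc q)) where

  private
    p : ℕ
    p = suc q

    instance
      q-nonZero : NonZero q
      q-nonZero = prime⇒pred-nonZero p-prime

  fermat : ∀ x → + p ∣ᶻ (+ x) ^ p - + x
  fermat zero = ℤ.divides 0ℤ refl
  fermat (suc x) = subst (+ p ∣ᶻ_) (sym expand) (ℤ.∣m∣n⇒∣m+n p∣middle (fermat x))
    where
    y : ℤ
    y = + x
    middle : ℤ
    middle = ∑[ i ∈ upTo q ] (+ (p C suc i) * y ^ suc i)
    p∣middle : + p ∣ᶻ middle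
    p∣middle = ∣ᶻ-∑ (All.applyUpTo⁺₁ (λ i → i) q (λ {i} i<q →
      ℤ.∣m⇒∣m*n (y ^ suc i) (ℤ.∣ᵤ⇒∣ {+ p} {+ (p C suc i)} (prime∣pCk p-prime (s≤s z≤n) (s≤s i<q)))))
    regroup : ∀ a b y → a - (y + 1ℤ) ≡ ((a - b) - 1ℤ) + (b - y)
    regroup = solve-∀
    expand : (+ suc x) ^ p - + suc x ≡ middle + (y ^ p - y)
    expand = begin
      (1ℤ + y) ^ p - (1ℤ + y)                      ≡⟨ cong (λ z → z ^ p - z) (ℤ.+-comm 1ℤ y) ⟩
      (y + 1ℤ) ^ p - (y + 1ℤ)                      ≡⟨ regroup ((y + 1ℤ) ^ p) (y ^ p) y ⟩
      (((y + 1ℤ) ^ p - y ^ p) - 1ℤ) + (y ^ p - y)  ≡⟨ cong (λ z → (z - 1ℤ) + (y ^ p - y)) expansion ⟩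
      ((1ℤ + middle) - 1ℤ) + (y ^ p - y)           ≡⟨ cong (_+ (y ^ p - y)) (cancel middle) ⟩
      middle + (y ^ p - y)                         ∎
      where
      expansion : (y + 1ℤ) ^ p - y ^ p ≡ 1ℤ + middle
      expansion = trans (binomial-difference q y) (∑-upTo-suc q (λ i → + (p C i) * y ^ i))
      cancel : ∀ a → (1ℤ + a) - 1ℤ ≡ a
      cancel = solve-∀

  powerSum-low : ∀ t → t < q → + p ∣ᶻ powerSum p t
  powerSum-low = <-rec (λ t → t < q → + p ∣ᶻ powerSum p t) low
    where
    low : ∀ t → (∀ {i} → i < t → i < q → + p ∣ᶻ powerSum p i) → t < q → + p ∣ᶻ powerSum p t
    low t IH t<q = euclidsLemmaᶻ (powerSum p t) p-prime p∣[1+t]S (ℕ.>⇒∤ (s≤s t<q))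
      where
      term : ℕ → ℤ
      term i = + (suc t C i) * powerSum p i
      p∣lower : + p ∣ᶻ ∑[ i ∈ upTo t ] term i
      p∣lower = ∣ᶻ-∑ (All.applyUpTo⁺₁ (λ i → i) t (λ {i} i<t →
        ℤ.∣n⇒∣m*n (+ (suc t C i)) (IH i<t (ℕ.<-trans i<t t<q))))
      p∣all : + p ∣ᶻ ∑[ i ∈ upTo t ] term i + term t
      p∣all = subst (+ p ∣ᶻ_) (trans (sym (powerSum-recurrence p t)) (∑-upTo-∷ʳ t term))
        (ℤ.∣m⇒∣m*n ((+ p) ^ t) ℤ.∣-refl)
      p∣[1+t]S : + p ∣ᶻ + suc t * powerSum p t
      p∣[1+t]S = subst (λ c → + p ∣ᶻ + c * powerSum p t) ([1+n]Cn≡1+n t) (ℤ.∣m+n∣m⇒∣n p∣all p∣lower)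

  powerSum-top : + p ∣ᶻ powerSum p q + 1ℤ
  powerSum-top = subst (+ p ∣ᶻ_) (sym regrouped) (ℤ.∣m∣n⇒∣m+n p∣units ℤ.∣-refl)
    where
    units : ℤ
    units = ∑[ x ∈ upTo q ] (+ suc x) ^ q
    p∣unit : ∀ {x} → x < q → + p ∣ᶻ (+ suc x) ^ q - 1ℤ
    p∣unit {x} x<q = euclidsLemmaᶻ ((+ suc x) ^ q - 1ℤ) p-prime
      (subst (+ p ∣ᶻ_) (factor (+ suc x) ((+ suc x) ^ q)) (fermat (suc x)))
      (ℕ.>⇒∤ (s≤s x<q))
      where
      factor : ∀ a b → a * b - a ≡ a * (b - 1ℤ)
      factor = solve-∀
    p∣units : + p ∣ᶻ units - + q * 1ℤ
    p∣units = subst (+ p ∣ᶻ_)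
      (trans (∑-distrib-- (upTo q) (λ x → (+ suc x) ^ q) (λ _ → 1ℤ))
        (cong (λ c → units - c) (trans (∑-const (upTo q) 1ℤ) (cong (λ n → + n * 1ℤ) (List.length-upTo q)))))
      (∣ᶻ-∑ (All.applyUpTo⁺₁ (λ x → x) q p∣unit))
    0^q≡0 : 0ℤ ^ q ≡ 0ℤ
    0^q≡0 = cong (0ℤ ^_) (sym (ℕ.suc-pred q))
    regroup : ∀ u q → (0ℤ + u) + 1ℤ ≡ (u - q * 1ℤ) + (1ℤ + q)
    regroup = solve-∀
    regrouped : powerSum p q + 1ℤ ≡ (units - + q * 1ℤ) + + p
    regrouped = begin
      powerSum p q + 1ℤ              ≡⟨ cong (_+ 1ℤ) (∑-upTo-suc q (λ x → (+ x) ^ q)) ⟩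
      (0ℤ ^ q + units) + 1ℤ          ≡⟨ cong (λ z → (z + units) + 1ℤ) 0^q≡0 ⟩
      (0ℤ + units) + 1ℤ              ≡⟨ regroup units (+ q) ⟩
      (units - + q * 1ℤ) + + p       ∎

  powerSum-period : ∀ t → + p ∣ᶻ powerSum p (suc t ℕ.+ q) - powerSum p (suc t)
  powerSum-period t = subst (+ p ∣ᶻ_) (∑-distrib-- (upTo p) (λ x → (+ x) ^ (suc t ℕ.+ q)) (λ x → (+ x) ^ suc t))
    (∣ᶻ-∑ (All.applyUpTo⁺₂ (λ x → x) p (λ x →
      subst (+ p ∣ᶻ_) (sym (factor x)) (ℤ.∣n⇒∣m*n ((+ x) ^ t) (fermat x)))))
    where
    factor : ∀ x → (+ x) ^ (suc t ℕ.+ q) - (+ x) ^ suc t ≡ (+ x) ^ t * ((+ x) ^ p - + x)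
    factor x = begin
      (+ x) ^ (suc t ℕ.+ q) - (+ x) ^ suc t   ≡⟨ cong (λ e → (+ x) ^ e - (+ x) ^ suc t) (sym (ℕ.+-suc t q)) ⟩
      (+ x) ^ (t ℕ.+ p) - (+ x) ^ suc t       ≡⟨ cong (_- (+ x) ^ suc t) (ℤ.^-distribˡ-+-* (+ x) t p) ⟩
      (+ x) ^ t * (+ x) ^ p - + x * (+ x) ^ t ≡⟨ distrib (+ x) ((+ x) ^ t) ((+ x) ^ p) ⟩
      (+ x) ^ t * ((+ x) ^ p - + x)           ∎
      where
      distrib : ∀ a b c → b * c - a * b ≡ b * (c - a)
      distrib = solve-∀

  powerSum-mod : ∀ t → 0 < t → + p ∣ᶻ powerSum p t + ⟦ q ∣? t ⟧
  powerSum-mod (suc s) _ = periodic-induction Q q base step s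
    where
    Q : ℕ → Set
    Q s = + p ∣ᶻ powerSum p (suc s) + ⟦ q ∣? suc s ⟧
    base : ∀ {s} → s < q → Q s
    base {s} s<q with ℕ.m≤n⇒m<n∨m≡n s<q
    ... | inj₁ 1+s<q = subst (λ c → + p ∣ᶻ powerSum p (suc s) + c)
      (sym (⟦⟧-no (q ∣? suc s) (ℕ.>⇒∤ 1+s<q)))
      (subst (+ p ∣ᶻ_) (sym (ℤ.+-identityʳ _)) (powerSum-low (suc s) 1+s<q))
    ... | inj₂ refl = subst (λ c → + p ∣ᶻ powerSum p q + c)
      (sym (⟦⟧-yes (q ∣? q) ℕ.∣-refl)) powerSum-top
    step : ∀ {s} → Q s → Q (s ℕ.+ q)
    step {s} Qs = subst (+ p ∣ᶻ_) telescoped (ℤ.∣m∣n⇒∣m+n (powerSum-period s) Qs)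
      where
      regroup : ∀ a b c → (a - b) + (b + c) ≡ a + c
      regroup = solve-∀
      telescoped : (powerSum p (suc s ℕ.+ q) - powerSum p (suc s)) + (powerSum p (suc s) + ⟦ q ∣? suc s ⟧)
                 ≡ powerSum p (suc s ℕ.+ q) + ⟦ q ∣? suc s ℕ.+ q ⟧
      telescoped = trans (regroup (powerSum p (suc s ℕ.+ q)) (powerSum p (suc s)) ⟦ q ∣? suc s ⟧)
        (cong (_+_ (powerSum p (suc s ℕ.+ q))) (sym (⟦∣⟧-periodic q (suc s))))

  p∣reducedCoeff : ∀ {n} → WeaklyAlmostPrime n → p ∣ n → ∀ e → + p ∣ᶻ reducedCoeff n q e
  p∣reducedCoeff {n} (_ , n∣T) p∣n e =
    ℤ.∣m+n∣m⇒∣n (subst (+ p ∣ᶻ_) (sym combined) p∣combined) p∣moment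
    where
    D : List ℕ
    D = divisors n
    K : ℤ
    K = + numDivisors n
    S+I : ℕ → ℤ
    S+I t = powerSum p t + ⟦ q ∣? t ⟧
    p∣moment : + p ∣ᶻ ∑[ x ∈ upTo p ] (+ x) ^ e * T n (+ x)
    p∣moment = ∣ᶻ-∑ (All.applyUpTo⁺₂ (λ x → x) p (λ x →
      ℤ.∣n⇒∣m*n ((+ x) ^ e) (ℤ.∣-trans (ℤ.∣ᵤ⇒∣ {+ p} {+ n} p∣n) (ℤ.∣ᵤ⇒∣ (n∣T (+ x))))))
    p∣combined : + p ∣ᶻ ∑[ d ∈ D ] S+I (d ℕ.+ e) - K * S+I (suc e)
    p∣combined = ℤ.∣m∣n⇒∣m-n
      (∣ᶻ-∑ (All.map (λ {d} 0<d → powerSum-mod (d ℕ.+ e) (ℕ.<-≤-trans 0<d (ℕ.m≤m+n d e)))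
                     (divisors-positive n)))
      (ℤ.∣n⇒∣m*n K (powerSum-mod (suc e) (s≤s z≤n)))
    regroup : ∀ a b c d k → (a - k * b) + (c - k * d) ≡ (a + c) - k * (b + d)
    regroup = solve-∀
    combined : ∑[ x ∈ upTo p ] (+ x) ^ e * T n (+ x) + reducedCoeff n q e ≡
               ∑[ d ∈ D ] S+I (d ℕ.+ e) - K * S+I (suc e)
    combined = begin
      ∑[ x ∈ upTo p ] (+ x) ^ e * T n (+ x) + reducedCoeff n q e
        ≡⟨ cong (_+ reducedCoeff n q e) (moment n p e) ⟩
      (∑[ d ∈ D ] powerSum p (d ℕ.+ e) - K * powerSum p (suc e)) + reducedCoeff n q e
        ≡⟨ regroup (∑[ d ∈ D ] powerSum p (d ℕ.+ e)) (powerSum p (suc e))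
                   (∑[ d ∈ D ] ⟦ q ∣? d ℕ.+ e ⟧) ⟦ q ∣? suc e ⟧ K ⟩
      (∑[ d ∈ D ] powerSum p (d ℕ.+ e) + ∑[ d ∈ D ] ⟦ q ∣? d ℕ.+ e ⟧) - K * S+I (suc e)
        ≡⟨ cong (_- K * S+I (suc e))
                (∑-distrib-+ D (λ d → powerSum p (d ℕ.+ e)) (λ d → ⟦ q ∣? d ℕ.+ e ⟧)) ⟨
      ∑[ d ∈ D ] S+I (d ℕ.+ e) - K * S+I (suc e) ∎

lemma2p1 : (n p : ℕ) → WeaklyAlmostPrime n → Prime p → p ∣ n →
    (m : ℕ) → m ∣ (p ∸ 1) → (r : ℤ) → ¬ ((+ m) ∣ℤ (r - + 1)) →
    p ∣ countDivisorsCong n m r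
lemma2p1 n zero _ p-prime with prime⇒nonTrivial p-prime
... | ()
lemma2p1 n p@(suc q) wap p-prime p∣n m m∣q r m∤r-1 =
  ℤ.∣⇒∣ᵤ (subst (+ p ∣ᶻ_) weighted≡count (∣ᶻ-∑ (All.applyUpTo⁺₂ (λ e → e) q (λ e →
    ℤ.∣n⇒∣m*n ⟦ m ∣? ℤ.∣ + e + r ∣ ⟧ (p∣reducedCoeff p-prime wap p∣n e)))))
  where
  instance
    q-nonZero : NonZero q
    q-nonZero = prime⇒pred-nonZero p-prime
  count : ℤ
  count = + countDivisorsCong n m r
  K : ℤ
  K = + numDivisors n
  weighted≡count : ∑[ e ∈ upTo q ] ⟦ m ∣? ℤ.∣ + e + r ∣ ⟧ * reducedCoeff n q e ≡ count
  weighted≡count = begin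
    ∑[ e ∈ upTo q ] ⟦ m ∣? ℤ.∣ + e + r ∣ ⟧ * reducedCoeff n q e  ≡⟨ residue-count n m∣q r ⟩
    count - K * ⟦ m ∣? ℤ.∣ + 1 - r ∣ ⟧                          ≡⟨ cong (λ c → count - K * c) (⟦⟧-no _ m∤1-r) ⟩
    count - K * 0ℤ                                              ≡⟨ drop count K ⟩
    count                                                       ∎
    where
    m∤1-r : ¬ m ∣ ℤ.∣ + 1 - r ∣
    m∤1-r m∣1-r = m∤r-1 (subst (m ∣_) (ℤ.∣i-j∣≡∣j-i∣ (+ 1) r) m∣1-r)
    drop : ∀ a k → a - k * 0ℤ ≡ a
    drop = solve-∀
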